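{- Let $G$ be a unicyclic graph, different from a cycle, whose unique cycle $C_t$ has $t\ge 3$ vertices. If $G$ has exactly one end-vertex (i.e. $|\tau(G)|=1$), then $pd_s(G)=3$.
   Context: Graphs are finite, simple, connected; $d_G$ is shortest-path distance, $d_G(x,W)=\min\{d_G(x,w):w\in W\}$. A set $W$ strongly resolves different vertices $x,y\notin W$ if $d_G(x,W)=d_G(x,y)+d_G(y,W)$ or $d_G(y,W)=d_G(y,x)+d_G(x,W)$. A vertex partition $\Pi$ is a strong resolving partition if every two different vertices in the same set of $\Pi$ are strongly resolved by some set of $\Pi$; $pd_s(G)$ is the minimum cardinality of such a partition. $\tau(G)$ denotes the set of end-vertices (vertices of degree one) of $G$. -}

module Defs where

open import Data.Nat using (ℕ; zero; suc; _+_; _≤_; _<_)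
open import Data.Fin using (Fin; toℕ)
open import Data.Bool using (Bool; true; false; if_then_else_)
open import Data.List using (List; []; _∷_; allFin; concatMap; map)
open import Data.Product using (_×_; _,_; ∃; Σ)
open import Data.Sum using (_⊎_)
open import Relation.Binary.PropositionalEquality using (_≡_; _≢_)
open import Relation.Nullary using (¬_)
open import Relation.Nullary.Decidable using (⌊_⌋)
import Data.Nat as ℕ

record Graph (n : ℕ) : Set where
  field
    adj     : Fin n → Fin n → Bool
    adj-sym : ∀ x y → adj x y ≡ adj y x
    adj-irr : ∀ x → adj x x ≡ false
open Graph public

count : {A : Set} → (A → Bool) → List A → ℕ
count p [] = 0
count p (a ∷ as) = if p a then suc (count p as) else count p as

degree : {n : ℕ} → Graph n → Fin n → ℕ
degree G x = count (adj G x) (allFin _)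

numEdges : {n : ℕ} → Graph n → ℕ
numEdges {n} G =
  count (λ p → ⌊ toℕ (Data.Product.proj₁ p) ℕ.<? toℕ (Data.Product.proj₂ p) ⌋ Data.Bool.∧
               adj G (Data.Product.proj₁ p) (Data.Product.proj₂ p))
        (concatMap (λ x → map (λ y → (x , y)) (allFin n)) (allFin n))

numEndVertices : {n : ℕ} → Graph n → ℕ
numEndVertices {n} G = count (λ x → ⌊ degree G x ℕ.≟ 1 ⌋) (allFin n)

data Walk {n : ℕ} (G : Graph n) : Fin n → Fin n → ℕ → Set where
  here : ∀ {x} → Walk G x x 0
  step : ∀ {x y z k} → adj G x y ≡ true → Walk G y z k → Walk G x z (suc k)

Connected : {n : ℕ} → Graph n → Set
Connected G = ∀ x y → ∃ λ k → Walk G x y k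

Dist : {n : ℕ} → Graph n → Fin n → Fin n → ℕ → Set
Dist G x y k = Walk G x y k × (∀ m → Walk G x y m → k ≤ m)

-- unicyclic graph: connected with as many edges as vertices
-- (equivalently, connected with exactly one cycle)
Unicyclic : {n : ℕ} → Graph n → Set
Unicyclic {n} G = Connected G × numEdges G ≡ n

IsCycleGraph : {n : ℕ} → Graph n → Set
IsCycleGraph {n} G = Connected G × (∀ x → degree G x ≡ 2)

record Partition {n : ℕ} (k : ℕ) : Set where
  field
    cls      : Fin n → Fin k
    nonempty : ∀ j → ∃ λ x → cls x ≡ j
open Partition public

DistToClass : {n k : ℕ} → Graph n → Partition {n} k → Fin n → Fin k → ℕ → Set
DistToClass G Π x j a =
  (∃ λ w → cls Π w ≡ j × Dist G x w a) ×
  (∀ w m → cls Π w ≡ j → Walk G x w m → a ≤ m)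

StronglyResolves : {n k : ℕ} → Graph n → Partition {n} k → Fin k → Fin n → Fin n → Set
StronglyResolves G Π j x y =
  cls Π x ≢ j × cls Π y ≢ j ×
  Σ ℕ λ dxW → Σ ℕ λ dyW → Σ ℕ λ dxy →
    DistToClass G Π x j dxW × DistToClass G Π y j dyW × Dist G x y dxy ×
    ((dxW ≡ dxy + dyW) ⊎ (dyW ≡ dxy + dxW))

IsStrongResolvingPartition : {n k : ℕ} → Graph n → Partition {n} k → Set
IsStrongResolvingPartition {n} {k} G Π =
  ∀ (x y : Fin n) → x ≢ y → cls Π x ≡ cls Π y →
    ∃ λ (j : Fin k) → StronglyResolves G Π j x y

StrongPartitionDimension : {n : ℕ} → Graph n → ℕ → Set
StrongPartitionDimension {n} G p =
  (Σ (Partition {n} p) λ Π → IsStrongResolvingPartition G Π) ×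
  (∀ k (Π : Partition {n} k) → IsStrongResolvingPartition G Π → p ≤ k)

{-# OPTIONS --safe #-}
module Submission where

-- Degree counting: the end-vertex u has degree 1, every other vertex has degree at least 2, and
-- the degrees sum to 2|E| = 2n, so exactly one vertex has degree 3 and all others degree 2.
-- Hence a non-backtracking walk s₀ = u, s₁, … traces the whole graph as a lasso: the path
-- s₀ … sᵢ followed by the cycle sᵢ … sⱼ₋₁, closed by sⱼ = sᵢ.
-- Lower bound: in a strong resolving partition with at most two classes, distinct vertices of one
-- class lie at different distances from the other class, which cannot happen around the
-- degree-3 vertex sᵢ.
-- Upper bound: take the classes {u}, the vertices whose geodesic to u runs back along the walk,
-- and those whose geodesic runs forward through sⱼ = sᵢ. Each of the last two classes lies on a
-- single geodesic to u, so {u} strongly resolves it; distances are certified by the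
-- 1-Lipschitz height k ↦ min(k, i + j − k).

open import Defs
open import Data.Bool using (Bool; true; false; if_then_else_; _∧_; not)
open import Data.Bool.Properties using (∧-zeroʳ; ∧-identityʳ; T-≡) renaming (_≟_ to _≟ᵇ_)
open import Data.Empty using (⊥; ⊥-elim)
open import Data.Fin using (Fin; zero; suc; toℕ; fromℕ<)
open import Data.Fin.Patterns using (0F; 1F; 2F)
open import Data.Fin.Properties using (_≟_; any?; toℕ<n; toℕ-fromℕ<; toℕ-injective; injective⇒≤)
open import Data.List using (List; []; _∷_; _++_; allFin; tabulate; concatMap; map; length)
open import Data.List.Membership.Propositional using (_∈_)
open import Data.List.Properties using (map-tabulate)
open import Data.List.Relation.Unary.All using (All; []; _∷_)
open import Data.List.Relation.Unary.All.Properties using (¬Any⇒All¬)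
open import Data.List.Relation.Unary.AllPairs using ([]; _∷_)
open import Data.List.Relation.Unary.Any using (here; there) renaming (any? to anyᴸ?)
open import Data.List.Relation.Unary.Unique.Propositional using (Unique)
open import Data.Nat
  using (ℕ; zero; suc; pred; _+_; _*_; _∸_; _⊓_; _≤_; _<_; z≤n; s≤s; s≤s⁻¹; _<?_; _≤?_; >-nonZero)
  renaming (_≟_ to _≟ℕ_)
open import Data.Nat.Properties hiding (_≟_)
open import Algebra.Properties.CommutativeMonoid.Sum +-0-commutativeMonoid
  using (sum; sum-syntax; ∑-distrib-+; ∑-comm; sum-cong-≗)
open import Data.Product using (∃; ∃₂; _×_; _,_; proj₁; proj₂)
open import Data.Sum using (_⊎_; inj₁; inj₂; swap)
open import Function using (id; _∘_)
open import Function.Bundles using (Equivalence)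
open import Relation.Binary.Definitions using (tri<; tri≈; tri>)
open import Relation.Binary.PropositionalEquality
open import Relation.Nullary using (¬_; yes; no; does; contradiction)
open import Relation.Nullary.Decidable using (⌊_⌋; toWitness; fromWitness)

-- Counting over Fin n

indicator : Bool → ℕ
indicator b = if b then 1 else 0

indicator≤1 : ∀ b → indicator b ≤ 1
indicator≤1 true = ≤-refl
indicator≤1 false = z≤n

point : ∀ {n} → Fin n → ℕ → Fin n → ℕ
point a c z = if does (z ≟ a) then c else 0

point-≢ : ∀ {n} (a : Fin n) c {z} → z ≢ a → point a c z ≡ 0
point-≢ a c {z} z≢a with z ≟ a
... | yes z≡a = contradiction z≡a z≢a
... | no _ = refl

_∖_ : ∀ {n} → (Fin n → Bool) → Fin n → Fin n → Bool
(p ∖ a) z = p z ∧ not (does (z ≟ a))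

∖-≢ : ∀ {n} (p : Fin n → Bool) {a z} → z ≢ a → (p ∖ a) z ≡ p z
∖-≢ p {a} {z} z≢a with z ≟ a
... | yes z≡a = contradiction z≡a z≢a
... | no _ = ∧-identityʳ (p z)

∖-sound : ∀ {n} (p : Fin n → Bool) {a z} → (p ∖ a) z ≡ true → p z ≡ true × z ≢ a
∖-sound p {a} {z} e with z ≟ a
... | yes _ rewrite ∧-zeroʳ (p z) = contradiction e λ ()
... | no z≢a rewrite ∧-identityʳ (p z) = e , z≢a

sum-mono-≤ : ∀ {n} {f g : Fin n → ℕ} → (∀ z → f z ≤ g z) → sum f ≤ sum g
sum-mono-≤ {zero} f≤g = z≤n
sum-mono-≤ {suc n} f≤g = +-mono-≤ (f≤g zero) (sum-mono-≤ (f≤g ∘ suc))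

sum-const : ∀ n c → ∑[ z < n ] c ≡ n * c
sum-const zero c = refl
sum-const (suc n) c = cong (c +_) (sum-const n c)

sum-point : ∀ {n} (a : Fin n) c → sum (point a c) ≡ c
sum-point {suc n} zero c = trans (cong (c +_) (trans (sum-const n 0) (*-zeroʳ n))) (+-identityʳ c)
sum-point {suc n} (suc a) c = sum-point a c

sum-+-point : ∀ {n} (f : Fin n → ℕ) (a : Fin n) c → ∑[ z < n ] (f z + point a c z) ≡ sum f + c
sum-+-point f a c = trans (∑-distrib-+ f (point a c)) (cong (sum f +_) (sum-point a c))

count-++ : ∀ {A : Set} (p : A → Bool) xs ys → count p (xs ++ ys) ≡ count p xs + count p ys
count-++ p [] ys = refl
count-++ p (x ∷ xs) ys with p x
... | true = cong suc (count-++ p xs ys)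
... | false = count-++ p xs ys

count-tabulate : ∀ {A : Set} {n} (p : A → Bool) (f : Fin n → A) →
  count p (tabulate f) ≡ ∑[ z < n ] indicator (p (f z))
count-tabulate {n = zero} p f = refl
count-tabulate {n = suc n} p f with p (f zero)
... | true = cong suc (count-tabulate p (f ∘ suc))
... | false = count-tabulate p (f ∘ suc)

count-concatMap-tabulate : ∀ {A B : Set} {n} (p : B → Bool) (g : A → List B) (f : Fin n → A) →
  count p (concatMap g (tabulate f)) ≡ ∑[ z < n ] count p (g (f z))
count-concatMap-tabulate {n = zero} p g f = refl
count-concatMap-tabulate {n = suc n} p g f =
  trans (count-++ p (g (f zero)) _) (cong (count p (g (f zero)) +_) (count-concatMap-tabulate p g (f ∘ suc)))

count-remove : ∀ {n} (p : Fin n → Bool) a →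
  count p (allFin n) ≡ count (p ∖ a) (allFin n) + indicator (p a)
count-remove {n} p a = begin
  count p (allFin n)                                                 ≡⟨ count-tabulate p id ⟩
  ∑[ z < n ] indicator (p z)                                         ≡⟨ sum-cong-≗ split ⟩
  ∑[ z < n ] (indicator ((p ∖ a) z) + point a (indicator (p a)) z)  ≡⟨ sum-+-point _ a _ ⟩
  ∑[ z < n ] indicator ((p ∖ a) z) + indicator (p a)                 ≡⟨ cong (_+ _) (count-tabulate (p ∖ a) id) ⟨
  count (p ∖ a) (allFin n) + indicator (p a)                         ∎
  where
  open ≡-Reasoning
  split : ∀ z → indicator (p z) ≡ indicator ((p ∖ a) z) + point a (indicator (p a)) z
  split z with z ≟ a
  ... | yes refl rewrite ∧-zeroʳ (p z) = refl
  ... | no _ rewrite ∧-identityʳ (p z) = sym (+-identityʳ _)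

count-pos⇒∃ : ∀ {A : Set} (p : A → Bool) xs → 0 < count p xs → ∃ λ x → p x ≡ true
count-pos⇒∃ p (x ∷ xs) pos with p x in px
... | true = x , px
... | false = count-pos⇒∃ p xs pos

length≤count : ∀ {n} (p : Fin n → Bool) {ys} → Unique ys → All (λ y → p y ≡ true) ys →
  length ys ≤ count p (allFin n)
length≤count p [] [] = z≤n
length≤count p {a ∷ ys} (a∉ys ∷ unique) (pa ∷ pys) = begin
  suc (length ys)                             ≤⟨ s≤s (length≤count (p ∖ a) unique (removed a∉ys pys)) ⟩
  suc (count (p ∖ a) (allFin _))              ≡⟨ +-comm 1 _ ⟩
  count (p ∖ a) (allFin _) + indicator true   ≡⟨ cong (λ b → count (p ∖ a) (allFin _) + indicator b) pa ⟨
  count (p ∖ a) (allFin _) + indicator (p a)  ≡⟨ count-remove p a ⟨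
  count p (allFin _)                          ∎
  where
  open ≤-Reasoning
  removed : ∀ {zs} → All (a ≢_) zs → All (λ z → p z ≡ true) zs → All (λ z → (p ∖ a) z ≡ true) zs
  removed [] [] = []
  removed (a≢z ∷ a≢zs) (pz ∷ pzs) = trans (∖-≢ p (a≢z ∘ sym)) pz ∷ removed a≢zs pzs

∈-of-count≤length : ∀ {n} (p : Fin n → Bool) {ys y} → count p (allFin n) ≤ length ys →
  Unique ys → All (λ z → p z ≡ true) ys → p y ≡ true → y ∈ ys
∈-of-count≤length p {ys} {y} bound unique pys py with anyᴸ? (y ≟_) ys
... | yes y∈ys = y∈ys
... | no y∉ys =
  contradiction (≤-trans (length≤count p (¬Any⇒All¬ ys y∉ys ∷ unique) (py ∷ pys)) bound) (n≮n (length ys))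

sum-≥-two-points : ∀ {n} (g : Fin n → ℕ) {c x y} → x ≢ y → (∀ z → c ≤ g z) →
  n * c + g x + g y ≤ sum g + c + c
sum-≥-two-points {n} g {c} {x} {y} x≢y c≤g = begin
  n * c + g x + g y
    ≡⟨ cong (λ m → m + g x + g y) (sum-const n c) ⟨
  ∑[ z < n ] c + g x + g y
    ≡⟨ cong (_+ g y) (sum-+-point (λ _ → c) x (g x)) ⟨
  ∑[ z < n ] (c + point x (g x) z) + g y
    ≡⟨ sum-+-point (λ z → c + point x (g x) z) y (g y) ⟨
  ∑[ z < n ] (c + point x (g x) z + point y (g y) z)
    ≤⟨ sum-mono-≤ pointwise ⟩
  ∑[ z < n ] (g z + point x c z + point y c z)
    ≡⟨ sum-+-point (λ z → g z + point x c z) y c ⟩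
  ∑[ z < n ] (g z + point x c z) + c
    ≡⟨ cong (_+ c) (sum-+-point g x c) ⟩
  sum g + c + c ∎
  where
  open ≤-Reasoning
  pointwise : ∀ z → c + point x (g x) z + point y (g y) z ≤ g z + point x c z + point y c z
  pointwise z with z ≟ x | z ≟ y
  ... | yes refl | yes refl = contradiction refl x≢y
  ... | yes refl | no _    = ≤-reflexive (cong (_+ 0) (+-comm c (g z)))
  ... | no _     | yes refl rewrite +-identityʳ c | +-identityʳ (g z) = ≤-reflexive (+-comm c (g z))
  ... | no _     | no _    = +-monoˡ-≤ 0 (+-monoˡ-≤ 0 (c≤g z))

handshake : ∀ {n} (G : Graph n) → ∑[ x < n ] degree G x ≡ 2 * numEdges G
handshake {n} G = begin
  ∑[ x < n ] degree G x                            ≡⟨ sum-cong-≗ (λ x → count-tabulate (adj G x) id) ⟩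
  ∑[ x < n ] ∑[ y < n ] indicator (adj G x y)      ≡⟨ sum-cong-≗ (λ x → sum-cong-≗ (split x)) ⟩
  ∑[ x < n ] ∑[ y < n ] (ι x y + ι y x)            ≡⟨ sum-cong-≗ (λ x → ∑-distrib-+ (ι x) (λ y → ι y x)) ⟩
  ∑[ x < n ] (∑[ y < n ] ι x y + ∑[ y < n ] ι y x) ≡⟨ ∑-distrib-+ (λ x → ∑[ y < n ] ι x y) _ ⟩
  E + ∑[ x < n ] ∑[ y < n ] ι y x                  ≡⟨ cong (E +_) (∑-comm (λ x y → ι y x)) ⟩
  E + E                                            ≡⟨ cong (E +_) (+-identityʳ E) ⟨
  2 * E                                            ≡⟨ cong (2 *_) edges ⟨
  2 * numEdges G                                   ∎
  where
  open ≡-Reasoning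
  ι : Fin n → Fin n → ℕ
  ι x y = indicator (⌊ toℕ x <? toℕ y ⌋ ∧ adj G x y)
  E : ℕ
  E = ∑[ x < n ] ∑[ y < n ] ι x y
  edges : numEdges G ≡ E
  edges = trans (count-concatMap-tabulate edge? (λ x → map (x ,_) (allFin n)) id) (sum-cong-≗ λ x →
            trans (cong (count edge?) (map-tabulate id (x ,_))) (count-tabulate edge? (x ,_)))
    where
    edge? : Fin n × Fin n → Bool
    edge? (x , y) = ⌊ toℕ x <? toℕ y ⌋ ∧ adj G x y
  split : ∀ x y → indicator (adj G x y) ≡ ι x y + ι y x
  split x y with toℕ x <? toℕ y | toℕ y <? toℕ x
  ... | yes x<y | yes y<x = contradiction x<y (<-asym y<x)
  ... | yes _   | no _    = sym (+-identityʳ _)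
  ... | no _    | yes _   = cong indicator (adj-sym G x y)
  ... | no x≮y  | no y≮x rewrite toℕ-injective (≤-antisym (≮⇒≥ y≮x) (≮⇒≥ x≮y)) | adj-irr G y = refl

-- Walks and distances

adjacent-≢ : ∀ {n} (G : Graph n) {x y} → adj G x y ≡ true → x ≢ y
adjacent-≢ G {x} e refl = contradiction (trans (sym (adj-irr G x)) e) λ ()

adj-flip : ∀ {n} (G : Graph n) {x y} → adj G x y ≡ true → adj G y x ≡ true
adj-flip G {x} {y} e = trans (adj-sym G y x) e

module _ {n} {G : Graph n} where

  walk-zero : ∀ {x y} → Walk G x y 0 → x ≡ y
  walk-zero here = refl

  _++ʷ_ : ∀ {x y z a b} → Walk G x y a → Walk G y z b → Walk G x z (a + b)
  here ++ʷ q = q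
  step e p ++ʷ q = step e (p ++ʷ q)

  snocʷ : ∀ {x y z a} → Walk G x y a → adj G y z ≡ true → Walk G x z (suc a)
  snocʷ here e = step e here
  snocʷ (step e' p) e = step e' (snocʷ p e)

  reverseʷ : ∀ {x y a} → Walk G x y a → Walk G y x a
  reverseʷ here = here
  reverseʷ (step e p) = snocʷ (reverseʷ p) (adj-flip G e)

  Dist-sym : ∀ {x y a} → Dist G x y a → Dist G y x a
  Dist-sym (p , minimal) = reverseʷ p , λ m q → minimal m (reverseʷ q)

  Dist-pos : ∀ {x y a} → x ≢ y → Dist G x y a → 0 < a
  Dist-pos {a = zero} x≢y (p , _) = contradiction (walk-zero p) x≢y
  Dist-pos {a = suc a} _ _ = s≤s z≤n

  StronglyResolves-sym : ∀ {k} {Π : Partition k} {W x y} →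
    StronglyResolves G Π W x y → StronglyResolves G Π W y x
  StronglyResolves-sym (x∉W , y∉W , a , b , d , dx , dy , dxy , split) =
    y∉W , x∉W , b , a , d , dy , dx , Dist-sym dxy , swap split

  module DistanceToClass {k} (Π : Partition {n} k) (W : Fin k) where

    DistToClass-unique : ∀ {x a b} → DistToClass G Π x W a → DistToClass G Π x W b → a ≡ b
    DistToClass-unique ((w , w∈W , p , _) , a-min) ((w' , w'∈W , p' , _) , b-min) =
      ≤-antisym (a-min w' _ w'∈W p') (b-min w _ w∈W p)

    DistToClass-pos : ∀ {x a} → cls Π x ≢ W → DistToClass G Π x W a → 0 < a
    DistToClass-pos {a = zero} x∉W ((w , w∈W , p , _) , _) =
      contradiction (trans (cong (cls Π) (walk-zero p)) w∈W) x∉W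
    DistToClass-pos {a = suc a} _ _ = s≤s z≤n

    DistToClass-adj : ∀ {x y a b} → adj G x y ≡ true →
      DistToClass G Π x W a → DistToClass G Π y W b → a ≤ suc b
    DistToClass-adj e (_ , a-min) ((w , w∈W , p , _) , _) = a-min w _ w∈W (step e p)

    DistToClass-≤1 : ∀ {x y a} → adj G x y ≡ true → cls Π y ≡ W → DistToClass G Π x W a → a ≤ 1
    DistToClass-≤1 e y∈W (_ , a-min) = a-min _ _ y∈W (step e here)

  module Potential {k} (Π : Partition {n} k) (W : Fin k) (h : Fin n → ℕ)
    (h-lipschitz : ∀ {x y} → adj G x y ≡ true → h x ≤ suc (h y))
    (h-vanishes : ∀ {w} → cls Π w ≡ W → h w ≡ 0)
    (h-attained : ∀ x → ∃ λ w → cls Π w ≡ W × Walk G x w (h x)) where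

    walk-length-bound : ∀ {x y m} → Walk G x y m → h x ≤ m + h y
    walk-length-bound here = ≤-refl
    walk-length-bound (step e p) = ≤-trans (h-lipschitz e) (s≤s (walk-length-bound p))

    walk-to-class-bound : ∀ {x w m} → cls Π w ≡ W → Walk G x w m → h x ≤ m
    walk-to-class-bound {m = m} w∈W p =
      ≤-trans (walk-length-bound p) (≤-reflexive (trans (cong (m +_) (h-vanishes w∈W)) (+-identityʳ m)))

    distToClass : ∀ x → DistToClass G Π x W (h x)
    distToClass x with h-attained x
    ... | w , w∈W , p =
      (w , w∈W , p , λ _ → walk-to-class-bound w∈W) , λ _ _ w'∈W → walk-to-class-bound w'∈W

    geodesic : ∀ {x y d} → Walk G x y d → h x ≡ d + h y → Dist G x y d
    geodesic {y = y} {d} p hx =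
      p , λ m q → +-cancelʳ-≤ (h y) d m (subst (_≤ m + h y) hx (walk-length-bound q))

    resolves : ∀ {x y d} → cls Π x ≢ W → cls Π y ≢ W → Walk G x y d → h x ≡ d + h y →
      StronglyResolves G Π W x y
    resolves {x} {y} x∉W y∉W p hx =
      x∉W , y∉W , h x , h y , _ , distToClass x , distToClass y , geodesic p hx , inj₁ hx

-- Partitions into two classes

Offset : ℕ → ℕ → Set
Offset i f = f ≡ suc i ⊎ suc f ≡ i

offset : ∀ {i f} → f ≢ i → f ≤ suc i → i ≤ suc f → Offset i f
offset {i} {f} f≢i f≤1+i i≤1+f with <-cmp f i
... | tri< f<i _ _ = inj₂ (≤-antisym f<i i≤1+f)
... | tri≈ _ f≡i _ = contradiction f≡i f≢i
... | tri> _ _ f>i = inj₁ (≤-antisym f≤1+i f>i)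

offsets-collide : ∀ {i f f' f''} → Offset i f → Offset i f' → Offset i f'' →
  f ≡ f' ⊎ f ≡ f'' ⊎ f' ≡ f''
offsets-collide (inj₁ refl) (inj₁ refl) _           = inj₁ refl
offsets-collide (inj₁ refl) (inj₂ _)    (inj₁ refl) = inj₂ (inj₁ refl)
offsets-collide (inj₁ _)    (inj₂ p)    (inj₂ q)    = inj₂ (inj₂ (suc-injective (trans p (sym q))))
offsets-collide (inj₂ p)    (inj₂ q)    _           = inj₁ (suc-injective (trans p (sym q)))
offsets-collide (inj₂ _)    (inj₁ refl) (inj₁ refl) = inj₂ (inj₂ refl)
offsets-collide (inj₂ p)    (inj₁ _)    (inj₂ q)    = inj₂ (inj₁ (suc-injective (trans p (sym q))))

offset-above : ∀ {i f} → 0 < f → i ≤ 1 → Offset i f → f ≡ suc i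
offset-above _ _ (inj₁ f≡1+i) = f≡1+i
offset-above (s≤s _) (s≤s ()) (inj₂ refl)

other : Fin 2 → Fin 2
other zero = suc zero
other (suc _) = zero

other-≢ : ∀ c → other c ≢ c
other-≢ zero ()
other-≢ (suc zero) ()

≢⇒other : ∀ {a c : Fin 2} → a ≢ c → a ≡ other c
≢⇒other {zero}     {zero}     a≢c = contradiction refl a≢c
≢⇒other {zero}     {suc zero} _   = refl
≢⇒other {suc zero} {zero}     _   = refl
≢⇒other {suc zero} {suc zero} a≢c = contradiction refl a≢c

≢-unique : ∀ {a b c : Fin 2} → a ≢ c → b ≢ c → a ≡ b
≢-unique a≢c b≢c = trans (≢⇒other a≢c) (sym (≢⇒other b≢c))

record ThreeNeighbours {n} (G : Graph n) (v : Fin n) : Set where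
  field
    a b c : Fin n
    a≢b : a ≢ b
    a≢c : a ≢ c
    b≢c : b ≢ c
    va : adj G v a ≡ true
    vb : adj G v b ≡ true
    vc : adj G v c ≡ true

  unique : Unique (a ∷ b ∷ c ∷ [])
  unique = (a≢b ∷ a≢c ∷ []) ∷ (b≢c ∷ []) ∷ [] ∷ []

  adjacent : All (λ y → adj G v y ≡ true) (a ∷ b ∷ c ∷ [])
  adjacent = va ∷ vb ∷ vc ∷ []

module TwoClasses {n} {G : Graph n} {Π : Partition {n} 2} (resolving : IsStrongResolvingPartition G Π) where

  -- With two classes, only the other class can resolve two vertices of one class.
  separated : ∀ {x y W} → x ≢ y → cls Π x ≡ cls Π y → W ≢ cls Π x →
    ∃₂ λ a b → DistToClass G Π x W a × DistToClass G Π y W b × a ≢ b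
  separated {x} {y} {W} x≢y same W≢x with resolving x y x≢y same
  ... | W' , x∉W' , _ , a , b , d , dx , dy , dxy , split
    with ≢-unique (x∉W' ∘ sym) W≢x
  ... | refl = a , b , dx , dy , a≢b split
    where
    a≢b : a ≡ d + b ⊎ b ≡ d + a → a ≢ b
    a≢b (inj₁ e) refl = <⇒≢ (m<n+m a (Dist-pos x≢y dxy)) e
    a≢b (inj₂ e) refl = <⇒≢ (m<n+m a (Dist-pos x≢y dxy)) e

  -- Two neighbours of v outside its class A would both be at distance 1 from A. Neighbours
  -- inside A are at distance d(v, B) ± 1 from B and pairwise at different distances, so there
  -- are at most two of them, and two only if d(v, B) ≥ 2, i.e. if no neighbour lies in B.
  module _ {v : Fin n} where

    private
      A B : Fin 2
      A = cls Π v
      B = other A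

    open DistanceToClass {G = G} Π B

    apart : ∀ {y z f f'} → y ≢ z → cls Π y ≡ A → cls Π z ≡ A →
      DistToClass G Π y B f → DistToClass G Π z B f' → f ≢ f'
    apart {y} {z} y≢z y∈A z∈A dy dz
      with separated {y} {z} {B} y≢z (trans y∈A (sym z∈A)) (subst (B ≢_) (sym y∈A) (other-≢ A))
    ... | _ , _ , dy' , dz' , differ =
      λ e → differ (trans (DistToClass-unique dy' dy) (trans e (DistToClass-unique dz dz')))

    neighbour-offset : ∀ {y i} → adj G v y ≡ true → cls Π y ≡ A → DistToClass G Π v B i →
      ∃ λ f → DistToClass G Π y B f × Offset i f × 0 < f
    neighbour-offset {y} vy y∈A dv with separated {v} {y} {B} (adjacent-≢ G vy) (sym y∈A) (other-≢ A)
    ... | _ , f , dv' , dy , differ =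
      f , dy ,
      offset (λ e → differ (trans (DistToClass-unique dv' dv) (sym e)))
             (DistToClass-adj (adj-flip G vy) dy dv) (DistToClass-adj vy dv dy) ,
      DistToClass-pos (λ e → other-≢ A (trans (sym e) y∈A)) dy

    distance-of-centre : ∀ {y} → adj G v y ≡ true → cls Π y ≡ A → ∃ λ i → DistToClass G Π v B i
    distance-of-centre vy y∈A with separated {v} {_} {B} (adjacent-≢ G vy) (sym y∈A) (other-≢ A)
    ... | i , _ , dv , _ = i , dv

    three-inside : ∀ {a b c} → a ≢ b → a ≢ c → b ≢ c →
      adj G v a ≡ true → adj G v b ≡ true → adj G v c ≡ true →
      cls Π a ≡ A → cls Π b ≡ A → cls Π c ≡ A → ⊥
    three-inside a≢b a≢c b≢c va vb vc a∈A b∈A c∈A with distance-of-centre va a∈A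
    ... | i , dv with neighbour-offset va a∈A dv | neighbour-offset vb b∈A dv | neighbour-offset vc c∈A dv
    ... | _ , da , oa , _ | _ , db , ob , _ | _ , dc , oc , _ with offsets-collide oa ob oc
    ... | inj₁ e = apart a≢b a∈A b∈A da db e
    ... | inj₂ (inj₁ e) = apart a≢c a∈A c∈A da dc e
    ... | inj₂ (inj₂ e) = apart b≢c b∈A c∈A db dc e

    two-inside : ∀ {a b c} → a ≢ b → adj G v a ≡ true → adj G v b ≡ true → adj G v c ≡ true →
      cls Π a ≡ A → cls Π b ≡ A → cls Π c ≢ A → ⊥
    two-inside a≢b va vb vc a∈A b∈A c∉A with distance-of-centre va a∈A
    ... | i , dv with neighbour-offset va a∈A dv | neighbour-offset vb b∈A dv
    ... | _ , da , oa , fa>0 | _ , db , ob , fb>0 =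
      apart a≢b a∈A b∈A da db (trans (offset-above fa>0 i≤1 oa) (sym (offset-above fb>0 i≤1 ob)))
      where
      i≤1 : i ≤ 1
      i≤1 = DistToClass-≤1 vc (≢⇒other c∉A) dv

    two-outside : ∀ {a b} → a ≢ b → adj G v a ≡ true → adj G v b ≡ true →
      cls Π a ≢ A → cls Π b ≢ A → ⊥
    two-outside {a} {b} a≢b va vb a∉A b∉A with separated {a} {b} {A} a≢b (≢-unique a∉A b∉A) (a∉A ∘ sym)
    ... | _ , _ , da , db , differ =
      differ (trans (at-distance-one va a∉A da) (sym (at-distance-one vb b∉A db)))
      where
      open DistanceToClass {G = G} Π A renaming (DistToClass-≤1 to ≤1; DistToClass-pos to pos)
      at-distance-one : ∀ {x d} → adj G v x ≡ true → cls Π x ≢ A → DistToClass G Π x A d → d ≡ 1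
      at-distance-one {x} vx x∉A dx = ≤-antisym (≤1 (adj-flip G vx) refl dx) (pos x∉A dx)

    no-three-neighbours : ThreeNeighbours G v → ⊥
    no-three-neighbours record { a = a ; b = b ; c = c ; a≢b = a≢b ; a≢c = a≢c ; b≢c = b≢c
                               ; va = va ; vb = vb ; vc = vc }
      with cls Π a ≟ A | cls Π b ≟ A | cls Π c ≟ A
    ... | yes a∈A | yes b∈A | yes c∈A = three-inside a≢b a≢c b≢c va vb vc a∈A b∈A c∈A
    ... | yes a∈A | yes b∈A | no c∉A  = two-inside a≢b va vb vc a∈A b∈A c∉A
    ... | yes a∈A | no b∉A  | yes c∈A = two-inside a≢c va vc vb a∈A c∈A b∉A
    ... | no a∉A  | yes b∈A | yes c∈A = two-inside b≢c vb vc va b∈A c∈A a∉A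
    ... | _       | no b∉A  | no c∉A  = two-outside b≢c vb vc b∉A c∉A
    ... | no a∉A  | _       | no c∉A  = two-outside a≢c va vc a∉A c∉A
    ... | no a∉A  | no b∉A  | _       = two-outside a≢b va vb a∉A b∉A

three-neighbours⇒3≤classes : ∀ {n} {G : Graph n} {v} → ThreeNeighbours G v →
  ∀ k (Π : Partition k) → IsStrongResolvingPartition G Π → 3 ≤ k
three-neighbours⇒3≤classes {v = v} _ zero Π _ with cls Π v
... | ()
three-neighbours⇒3≤classes {G = G} {v} N 1 Π resolving
  with cls Π v in cv | cls Π (ThreeNeighbours.a N) in ca
... | zero | zero with resolving v _ (adjacent-≢ G (ThreeNeighbours.va N)) (trans cv (sym ca))
...   | zero , v∉W , _ = contradiction cv v∉W
three-neighbours⇒3≤classes {G = G} {v} N 2 Π resolving =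
  ⊥-elim (TwoClasses.no-three-neighbours {G = G} {Π} resolving {v} N)
three-neighbours⇒3≤classes _ (suc (suc (suc k))) _ _ = s≤s (s≤s (s≤s z≤n))

-- Lassos and tadpoles

InjectiveBelow : ∀ {A : Set} → ℕ → (ℕ → A) → Set
InjectiveBelow N f = ∀ {a b} → a < N → b < N → f a ≡ f b → a ≡ b

FirstRepetition : ∀ {A : Set} → (ℕ → A) → ℕ → ℕ → Set
FirstRepetition f i j = i < j × f j ≡ f i × InjectiveBelow j f

module _ {n} (f : ℕ → Fin n) where

  extend-injective : ∀ {N} → InjectiveBelow N f → (∀ {a} → a < N → f N ≢ f a) → InjectiveBelow (suc N) f
  extend-injective {N} injective fresh {a} {b} a<1+N b<1+N fa≡fb
    with m≤n⇒m<n∨m≡n (s≤s⁻¹ a<1+N) | m≤n⇒m<n∨m≡n (s≤s⁻¹ b<1+N)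
  ... | inj₁ a<N  | inj₁ b<N  = injective a<N b<N fa≡fb
  ... | inj₁ a<N  | inj₂ refl = contradiction (sym fa≡fb) (fresh a<N)
  ... | inj₂ refl | inj₁ b<N  = contradiction fa≡fb (fresh b<N)
  ... | inj₂ refl | inj₂ refl = refl

  injective-or-repetition : ∀ N → InjectiveBelow N f ⊎ ∃₂ (FirstRepetition f)
  injective-or-repetition zero = inj₁ λ ()
  injective-or-repetition (suc N) with injective-or-repetition N
  ... | inj₂ repetition = inj₂ repetition
  ... | inj₁ injective with any? (λ (a : Fin N) → f N ≟ f (toℕ a))
  ...   | yes (a , fN≡fa) = inj₂ (toℕ a , N , toℕ<n a , fN≡fa , injective)
  ...   | no fresh = inj₁ (extend-injective injective λ {a} a<N fN≡fa →
                         fresh (fromℕ< a<N , trans fN≡fa (cong f (sym (toℕ-fromℕ< a<N)))))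

  first-repetition : ∃₂ (FirstRepetition f)
  first-repetition with injective-or-repetition (suc n)
  ... | inj₂ repetition = repetition
  ... | inj₁ injective =
    contradiction (injective⇒≤ (toℕ-injective ∘ injective (toℕ<n _) (toℕ<n _))) (n≮n n)

-- The walk s 0, …, s j visits distinct vertices until s j ≡ s i closes the cycle
-- s i, …, s (pred j); the values of s beyond j play no role.
record Lasso {n} (G : Graph n) : Set where
  field
    s : ℕ → Fin n
    i j : ℕ
    3+i≤j : 3 + i ≤ j
    s-injective : InjectiveBelow j s
    s-closes : s j ≡ s i
    s-adjacent : ∀ {k} → k < j → adj G (s k) (s (suc k)) ≡ true

  i<j : i < j
  i<j = ≤-trans (m≤n+m (suc i) 2) 3+i≤j

  0<j : 0 < j
  0<j = ≤-trans (s≤s z≤n) i<j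

  1<j : 1 < j
  1<j = ≤-trans (s≤s (s≤s z≤n)) (≤-trans (m≤m+n 3 i) 3+i≤j)

  after<last : suc i < pred j
  after<last = suc[m]≤n⇒m≤pred[n] 3+i≤j

  last<j : pred j < j
  last<j = ≤-reflexive (suc-pred j {{>-nonZero 0<j}})

  after<j : suc i < j
  after<j = <-trans after<last last<j

  s-last : s (suc (pred j)) ≡ s i
  s-last = trans (cong s (suc-pred j {{>-nonZero 0<j}})) s-closes

  last-adjacent : adj G (s i) (s (pred j)) ≡ true
  last-adjacent = adj-flip G (subst (λ x → adj G (s (pred j)) x ≡ true) s-last (s-adjacent last<j))

  s-distinct : ∀ {a b} → a < b → b < j → s a ≢ s b
  s-distinct a<b b<j e = <⇒≢ a<b (s-injective (<-trans a<b b<j) b<j e)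

  module _ (0<i : 0 < i) where

    before<after : pred i < suc i
    before<after = s≤s pred[n]≤n

    before<j : pred i < j
    before<j = <-trans before<after after<j

    s-before : s (suc (pred i)) ≡ s i
    s-before = cong s (suc-pred i {{>-nonZero 0<i}})

    junction-neighbours : ThreeNeighbours G (s i)
    junction-neighbours = record
      { a = s (pred i) ; b = s (suc i) ; c = s (pred j)
      ; a≢b = s-distinct before<after after<j
      ; a≢c = s-distinct (<-trans before<after after<last) last<j
      ; b≢c = s-distinct after<last last<j
      ; va = adj-flip G (subst (λ x → adj G (s (pred i)) x ≡ true) s-before (s-adjacent before<j))
      ; vb = s-adjacent i<j
      ; vc = last-adjacent
      }

Consecutive : ∀ {n} → (ℕ → Fin n) → ℕ → Fin n → Fin n → Set
Consecutive s j x y = ∃ λ k → k < j × (s k ≡ x × s (suc k) ≡ y ⊎ s k ≡ y × s (suc k) ≡ x)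

-- A lasso covering every vertex and every edge: G is a cycle of length j − i with a path of
-- length i attached to it.
record Tadpole {n} (G : Graph n) : Set where
  field
    lasso : Lasso G
  open Lasso lasso public
  field
    s-surjective : ∀ x → ∃ λ k → k < j × s k ≡ x
    s-edges : ∀ {x y} → adj G x y ≡ true → Consecutive s j x y

m∸n≤1+m∸[1+n] : ∀ m n → m ∸ n ≤ suc (m ∸ suc n)
m∸n≤1+m∸[1+n] zero zero = z≤n
m∸n≤1+m∸[1+n] zero (suc n) = z≤n
m∸n≤1+m∸[1+n] (suc m) zero = ≤-refl
m∸n≤1+m∸[1+n] (suc m) (suc n) = m∸n≤1+m∸[1+n] m n

∸-split : ∀ {a b c} → a ≤ b → b ≤ c → c ∸ a ≡ (b ∸ a) + (c ∸ b)
∸-split {a} {b} {c} a≤b b≤c = begin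
  c ∸ a               ≡⟨ cong (_∸ a) (m∸n+n≡m b≤c) ⟨
  (c ∸ b) + b ∸ a     ≡⟨ +-∸-assoc (c ∸ b) a≤b ⟩
  (c ∸ b) + (b ∸ a)   ≡⟨ +-comm (c ∸ b) (b ∸ a) ⟩
  (b ∸ a) + (c ∸ b)   ∎
  where open ≡-Reasoning

last-is-far : ∀ {i j} → 3 + i ≤ j → i + j ∸ pred j < pred j
last-is-far {i} {suc j} (s≤s 2+i≤j) =
  subst (_< j) (sym (trans (cong (_∸ j) (+-suc i j)) (m+n∸n≡m (suc i) j))) 2+i≤j

module TadpolePartition {n} {G : Graph n} (T : Tadpole G) where
  open Tadpole T

  index : Fin n → ℕ
  index x = proj₁ (s-surjective x)

  index<j : ∀ x → index x < j
  index<j x = proj₁ (proj₂ (s-surjective x))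

  s-index : ∀ x → s (index x) ≡ x
  s-index x = proj₂ (proj₂ (s-surjective x))

  index-s : ∀ {k} → k < j → index (s k) ≡ k
  index-s k<j = s-injective (index<j _) k<j (s-index _)

  path : ∀ a d → d + a ≤ j → Walk G (s a) (s (d + a)) d
  path a zero _ = here
  path a (suc d) d+a<j = snocʷ (path a d (<⇒≤ d+a<j)) (s-adjacent d+a<j)

  path-between : ∀ {a b} → a ≤ b → b ≤ j → Walk G (s a) (s b) (b ∸ a)
  path-between {a} {b} a≤b b≤j =
    subst (λ c → Walk G (s a) (s c) (b ∸ a)) d+a≡b (path a (b ∸ a) (≤-trans (≤-reflexive d+a≡b) b≤j))
    where
    d+a≡b : b ∸ a + a ≡ b
    d+a≡b = m∸n+n≡m a≤b

  -- The distance from s k to s 0: either back along the walk, or forward to s j ≡ s i and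
  -- then back along the path.
  height : ℕ → ℕ
  height k = k ⊓ (i + j ∸ k)

  height-≤-suc : ∀ k → height k ≤ suc (height (suc k))
  height-≤-suc k = ⊓-mono-≤ (m≤n+m k 2) (m∸n≤1+m∸[1+n] (i + j) k)

  height-suc-≤ : ∀ k → height (suc k) ≤ suc (height k)
  height-suc-≤ k = ⊓-monoʳ-≤ (suc k) (≤-trans (∸-monoʳ-≤ (i + j) (n≤1+n k)) (n≤1+n _))

  height-i : height i ≡ i
  height-i = trans (cong (i ⊓_) (m+n∸m≡n i j)) (m≤n⇒m⊓n≡m (<⇒≤ i<j))

  height-j : height j ≡ i
  height-j = trans (cong (j ⊓_) (m+n∸n≡m i j)) (m≥n⇒m⊓n≡n (<⇒≤ i<j))

  walk-to-root : ∀ {k} → k ≤ j → Walk G (s k) (s 0) (height k)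
  walk-to-root {k} k≤j with ⊓-sel k (i + j ∸ k)
  ... | inj₁ h≡k rewrite h≡k = reverseʷ (path-between z≤n k≤j)
  ... | inj₂ h≡around rewrite h≡around = subst (Walk G (s k) (s 0)) length≡ (forward ++ʷ back)
    where
    forward : Walk G (s k) (s i) (j ∸ k)
    forward = subst (λ c → Walk G (s k) c (j ∸ k)) s-closes (path-between k≤j ≤-refl)
    back : Walk G (s i) (s 0) i
    back = reverseʷ (path-between z≤n (<⇒≤ i<j))
    length≡ : (j ∸ k) + i ≡ i + j ∸ k
    length≡ = trans (+-comm (j ∸ k) i) (sym (+-∸-assoc i k≤j))

  h : Fin n → ℕ
  h x = height (index x)

  h-s : ∀ {k} → k ≤ j → h (s k) ≡ height k
  h-s k≤j with m≤n⇒m<n∨m≡n k≤j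
  ... | inj₁ k<j = cong height (index-s k<j)
  ... | inj₂ refl = trans (cong h s-closes) (trans (cong height (index-s i<j)) (trans height-i (sym height-j)))

  h-consecutive : ∀ {k} → k < j → h (s k) ≤ suc (h (s (suc k))) × h (s (suc k)) ≤ suc (h (s k))
  h-consecutive {k} k<j rewrite h-s (<⇒≤ k<j) | h-s k<j = height-≤-suc k , height-suc-≤ k

  h-lipschitz : ∀ {x y} → adj G x y ≡ true → h x ≤ suc (h y)
  h-lipschitz e with s-edges e
  ... | _ , k<j , inj₁ (refl , refl) = proj₁ (h-consecutive k<j)
  ... | _ , k<j , inj₂ (refl , refl) = proj₂ (h-consecutive k<j)

  data Side : ℕ → Fin 3 → Set where
    root : Side 0 0F
    near : ∀ {k} → 0 < k → k ≤ i + j ∸ k → Side k 1F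
    far  : ∀ {k} → i + j ∸ k < k → Side k 2F

  side : ℕ → Fin 3
  side zero = 0F
  side (suc k) with suc k ≤? i + j ∸ suc k
  ... | yes _ = 1F
  ... | no _ = 2F

  side-view : ∀ k → Side k (side k)
  side-view zero = root
  side-view (suc k) with suc k ≤? i + j ∸ suc k
  ... | yes k≤ = near (s≤s z≤n) k≤
  ... | no k≰ = far (≰⇒> k≰)

  Side-functional : ∀ {k c c'} → Side k c → Side k c' → c ≡ c'
  Side-functional root       root        = refl
  Side-functional root       (near () _)
  Side-functional root       (far ())
  Side-functional (near () _) root
  Side-functional (near _ _) (near _ _)  = refl
  Side-functional (near _ k≤) (far k>)   = contradiction k≤ (<⇒≱ k>)
  Side-functional (far ())   root
  Side-functional (far k>)   (near _ k≤) = contradiction k≤ (<⇒≱ k>)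
  Side-functional (far _)    (far _)     = refl

  side-s : ∀ {k c} → k < j → Side k c → side (index (s k)) ≡ c
  side-s {k} k<j view = trans (cong side (index-s k<j)) (Side-functional (side-view k) view)

  partition : Partition 3
  partition = record { cls = side ∘ index ; nonempty = occupied }
    where
    occupied : ∀ c → ∃ λ x → side (index x) ≡ c
    occupied 0F = s 0 , side-s 0<j root
    occupied 1F = s 1 , side-s 1<j (near (s≤s z≤n) (m+n≤o⇒m≤o∸n 1 (≤-trans 1<j (m≤n+m j i))))
    occupied 2F = s (pred j) , side-s last<j (far (last-is-far 3+i≤j))

  h-vanishes : ∀ {w} → cls partition w ≡ 0F → h w ≡ 0
  h-vanishes {w} w∈root = cong height (root-index (subst (Side (index w)) w∈root (side-view (index w))))
    where
    root-index : ∀ {k} → Side k 0F → k ≡ 0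
    root-index root = refl

  h-attained : ∀ x → ∃ λ w → cls partition w ≡ 0F × Walk G x w (h x)
  h-attained x =
    s 0 , side-s 0<j root , subst (λ y → Walk G y (s 0) (h x)) (s-index x) (walk-to-root (<⇒≤ (index<j x)))

  open Potential partition 0F h h-lipschitz h-vanishes h-attained

  off-root : ∀ {k c} → k < j → Side k c → c ≢ 0F → cls partition (s k) ≢ 0F
  off-root k<j view c≢0F s∈root = c≢0F (trans (sym (side-s k<j view)) s∈root)

  resolve-ordered : ∀ {a b c} → a < b → b < j → Side a c → Side b c →
    StronglyResolves G partition 0F (s a) (s b)
  resolve-ordered a<b _ root root = contradiction a<b (<-irrefl refl)
  resolve-ordered {a} {b} a<b b<j va@(near _ a-near) vb@(near _ b-near) =
    StronglyResolves-sym {Π = partition}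
      (resolves (off-root b<j vb λ ()) (off-root (<-trans a<b b<j) va λ ())
                (reverseʷ (path-between (<⇒≤ a<b) (<⇒≤ b<j))) descent)
    where
    open ≡-Reasoning
    descent : h (s b) ≡ (b ∸ a) + h (s a)
    descent = begin
      h (s b)            ≡⟨ h-s (<⇒≤ b<j) ⟩
      height b           ≡⟨ m≤n⇒m⊓n≡m b-near ⟩
      b                  ≡⟨ m∸n+n≡m (<⇒≤ a<b) ⟨
      (b ∸ a) + a        ≡⟨ cong ((b ∸ a) +_) (m≤n⇒m⊓n≡m a-near) ⟨
      (b ∸ a) + height a ≡⟨ cong ((b ∸ a) +_) (h-s (<⇒≤ (<-trans a<b b<j))) ⟨
      (b ∸ a) + h (s a)  ∎
  resolve-ordered {a} {b} a<b b<j va@(far a-far) vb@(far b-far) =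
    resolves (off-root (<-trans a<b b<j) va λ ()) (off-root b<j vb λ ())
             (path-between (<⇒≤ a<b) (<⇒≤ b<j)) descent
    where
    open ≡-Reasoning
    descent : h (s a) ≡ (b ∸ a) + h (s b)
    descent = begin
      h (s a)                    ≡⟨ h-s (<⇒≤ (<-trans a<b b<j)) ⟩
      height a                   ≡⟨ m≥n⇒m⊓n≡n (<⇒≤ a-far) ⟩
      i + j ∸ a                  ≡⟨ ∸-split (<⇒≤ a<b) (≤-trans (<⇒≤ b<j) (m≤n+m j i)) ⟩
      (b ∸ a) + (i + j ∸ b)      ≡⟨ cong ((b ∸ a) +_) (m≥n⇒m⊓n≡n (<⇒≤ b-far)) ⟨
      (b ∸ a) + height b         ≡⟨ cong ((b ∸ a) +_) (h-s (<⇒≤ b<j)) ⟨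
      (b ∸ a) + h (s b)          ∎

  resolve-by-index : ∀ {x y} → index x < index y → cls partition x ≡ cls partition y →
    StronglyResolves G partition 0F x y
  resolve-by-index {x} {y} x<y same =
    subst₂ (StronglyResolves G partition 0F) (s-index x) (s-index y)
      (resolve-ordered x<y (index<j y) (side-view (index x)) y-side)
    where
    y-side : Side (index y) (side (index x))
    y-side = subst (Side (index y)) (sym same) (side-view (index y))

  resolving : IsStrongResolvingPartition G partition
  resolving x y x≢y same with <-cmp (index x) (index y)
  ... | tri< x<y _ _ = 0F , resolve-by-index x<y same
  ... | tri≈ _ x≡y _ = contradiction (trans (sym (s-index x)) (trans (cong s x≡y) (s-index y))) x≢y
  ... | tri> _ _ y<x = 0F , StronglyResolves-sym {Π = partition} (resolve-by-index y<x (sym same))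

tadpole-lower-bound : ∀ {n} {G : Graph n} (T : Tadpole G) → 0 < Tadpole.i T →
  ∀ k (Π : Partition k) → IsStrongResolvingPartition G Π → 3 ≤ k
tadpole-lower-bound T 0<i = three-neighbours⇒3≤classes (Tadpole.junction-neighbours T 0<i)

-- Unicyclic graphs with one end-vertex

complement-bound : ∀ {a b k m} → a + b ≤ k + m → m ≤ b → a ≤ k
complement-bound {a} {b} {k} {m} a+b≤k+m m≤b = +-cancelʳ-≤ m a k (≤-trans (+-monoʳ-≤ a m≤b) a+b≤k+m)

module OneEndVertex {n} (G : Graph n) (unicyclic : Unicyclic G) (one-end : numEndVertices G ≡ 1) where

  isEnd : Fin n → Bool
  isEnd x = ⌊ degree G x ≟ℕ 1 ⌋

  end-vertex : ∃ λ u → isEnd u ≡ true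
  end-vertex = count-pos⇒∃ isEnd (allFin n) (≤-reflexive (sym one-end))

  u : Fin n
  u = proj₁ end-vertex

  degree-u : degree G u ≡ 1
  degree-u = toWitness (Equivalence.from T-≡ (proj₂ end-vertex))

  end-unique : ∀ {x} → degree G x ≡ 1 → x ≡ u
  end-unique d with ∈-of-count≤length isEnd (≤-reflexive one-end) ([] ∷ []) (proj₂ end-vertex ∷ [])
                      (Equivalence.to T-≡ (fromWitness d))
  ... | here x≡u = x≡u

  u-neighbour : ∃ λ w → adj G u w ≡ true
  u-neighbour = count-pos⇒∃ (adj G u) (allFin n) (≤-reflexive (sym degree-u))

  w : Fin n
  w = proj₁ u-neighbour

  u-neighbour-unique : ∀ {y} → adj G u y ≡ true → y ≡ w
  u-neighbour-unique e with ∈-of-count≤length (adj G u) (≤-reflexive degree-u) ([] ∷ []) (proj₂ u-neighbour ∷ []) e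
  ... | here y≡w = y≡w

  degree-≥2 : ∀ {x} → x ≢ u → 2 ≤ degree G x
  degree-≥2 {x} x≢u with proj₁ unicyclic x u
  ... | zero , p = contradiction (walk-zero p) x≢u
  ... | suc _ , step e _ = ≤∧≢⇒< (length≤count (adj G x) ([] ∷ []) (e ∷ [])) (x≢u ∘ end-unique ∘ sym)

  degree-pair-bound : ∀ {x y} → x ≢ y → x ≢ u → y ≢ u → degree G x + degree G y ≤ 5
  degree-pair-bound {x} {y} x≢y x≢u y≢u = +-cancelˡ-≤ (n * 2) _ _ (begin
    n * 2 + (degree G x + degree G y)  ≡⟨ +-assoc (n * 2) _ _ ⟨
    n * 2 + degree G x + degree G y    ≡⟨ cong₂ (λ a b → n * 2 + a + b) (g-off x≢u) (g-off y≢u) ⟨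
    n * 2 + g x + g y                  ≤⟨ sum-≥-two-points g x≢y g≥2 ⟩
    sum g + 2 + 2                      ≡⟨ cong (λ m → m + 2 + 2) sum-g ⟩
    n * 2 + 1 + 2 + 2                  ≡⟨ trans (+-assoc (n * 2 + 1) 2 2) (+-assoc (n * 2) 1 4) ⟩
    n * 2 + 5                          ∎)
    where
    open ≤-Reasoning
    -- Raising the degree of u by one makes every value at least 2, with total 2n + 1.
    g : Fin n → ℕ
    g z = degree G z + point u 1 z
    g≥2 : ∀ z → 2 ≤ g z
    g≥2 z with z ≟ u
    ... | yes refl = ≤-reflexive (cong (_+ 1) (sym degree-u))
    ... | no z≢u = ≤-trans (degree-≥2 z≢u) (m≤m+n _ _)
    g-off : ∀ {z} → z ≢ u → g z ≡ degree G z
    g-off z≢u = trans (cong (_ +_) (point-≢ u 1 z≢u)) (+-identityʳ _)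
    sum-g : sum g ≡ n * 2 + 1
    sum-g = trans (sum-+-point (degree G) u 1)
                  (cong (_+ 1) (trans (handshake G) (trans (cong (2 *_) (proj₂ unicyclic)) (*-comm 2 n))))

  -- A neighbour of c other than p; the junk value c only arises at c ≡ u.
  next : Fin n → Fin n → Fin n
  next p c with any? (λ z → (adj G c ∖ p) z ≟ᵇ true)
  ... | yes (z , _) = z
  ... | no _ = c

  next-spec : ∀ p {c} → c ≢ u → adj G c (next p c) ≡ true × next p c ≢ p
  next-spec p {c} c≢u with any? (λ z → (adj G c ∖ p) z ≟ᵇ true)
  ... | yes (_ , fresh) = ∖-sound (adj G c) fresh
  ... | no none = contradiction (degree-≥2 c≢u) (≤⇒≯ degree≤1)
    where
    open ≤-Reasoning
    no-fresh : count (adj G c ∖ p) (allFin n) ≡ 0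
    no-fresh = n≤0⇒n≡0 (≮⇒≥ (none ∘ count-pos⇒∃ (adj G c ∖ p) (allFin n)))
    degree≤1 : degree G c ≤ 1
    degree≤1 = begin
      degree G c                                               ≡⟨ count-remove (adj G c) p ⟩
      count (adj G c ∖ p) (allFin n) + indicator (adj G c p)   ≡⟨ cong (_+ _) no-fresh ⟩
      indicator (adj G c p)                                    ≤⟨ indicator≤1 _ ⟩
      1                                                        ∎

  s : ℕ → Fin n
  s zero = u
  s (suc zero) = w
  s (suc (suc k)) = next (s k) (s (suc k))

  repetition : ∃₂ (FirstRepetition s)
  repetition = first-repetition s

  i j : ℕ
  i = proj₁ repetition
  j = proj₁ (proj₂ repetition)

  i<j : i < j
  i<j = proj₁ (proj₂ (proj₂ repetition))

  s-closes : s j ≡ s i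
  s-closes = proj₁ (proj₂ (proj₂ (proj₂ repetition)))

  s-injective : InjectiveBelow j s
  s-injective = proj₂ (proj₂ (proj₂ (proj₂ repetition)))

  s-≢-u : ∀ {k} → 0 < k → k < j → s k ≢ u
  s-≢-u 0<k k<j e = <⇒≢ 0<k (sym (s-injective k<j (≤-trans (s≤s z≤n) i<j) e))

  s-adjacent : ∀ {k} → k < j → adj G (s k) (s (suc k)) ≡ true
  s-adjacent {zero} _ = proj₂ u-neighbour
  s-adjacent {suc k} k<j = proj₁ (next-spec (s k) (s-≢-u (s≤s z≤n) k<j))

  s-turns : ∀ {k} → suc k < j → s (suc (suc k)) ≢ s k
  s-turns {k} k+1<j = proj₂ (next-spec (s k) (s-≢-u (s≤s z≤n) k+1<j))

  -- j ≡ 1 + i would be a loop and j ≡ 2 + i a step back.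
  3+i≤j : 3 + i ≤ j
  3+i≤j with m≤n⇒m<n∨m≡n i<j
  ... | inj₂ 1+i≡j = contradiction (trans (cong s 1+i≡j) s-closes) (adjacent-≢ G (s-adjacent i<j) ∘ sym)
  ... | inj₁ 1+i<j with m≤n⇒m<n∨m≡n 1+i<j
  ...   | inj₂ 2+i≡j = contradiction (trans (cong s 2+i≡j) s-closes) (s-turns 1+i<j)
  ...   | inj₁ 2+i<j = 2+i<j

  lasso : Lasso G
  lasso = record
    { s = s ; i = i ; j = j ; 3+i≤j = 3+i≤j
    ; s-injective = s-injective ; s-closes = s-closes ; s-adjacent = s-adjacent }

  open Lasso lasso
    using ( 0<j; 1<j; after<last; last<j; after<j; before<j
          ; s-last; s-before; last-adjacent; s-distinct; junction-neighbours)

  -- The cycle cannot close at u, whose only neighbour is s 1.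
  0<i : 0 < i
  0<i = n≢0⇒n>0 i≢0
    where
    i≢0 : i ≢ 0
    i≢0 i≡0 = <⇒≢ (≤-trans (s≤s (s≤s z≤n)) after<last) (sym (s-injective last<j 1<j last≡w))
      where
      last≡w : s (pred j) ≡ s 1
      last≡w = u-neighbour-unique (subst (λ x → adj G x (s (pred j)) ≡ true) (cong s i≡0) last-adjacent)

  junction : ThreeNeighbours G (s i)
  junction = junction-neighbours 0<i

  open ThreeNeighbours junction using () renaming (unique to junction-unique; adjacent to junction-adjacent)

  s-i≢u : s i ≢ u
  s-i≢u = s-≢-u 0<i i<j

  degree-junction : degree G (s i) ≤ 3
  degree-junction = complement-bound
    (degree-pair-bound (s-distinct (n<1+n i) after<j) s-i≢u (s-≢-u (s≤s z≤n) after<j))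
    (degree-≥2 (s-≢-u (s≤s z≤n) after<j))

  degree-elsewhere : ∀ {x} → x ≢ u → x ≢ s i → degree G x ≤ 2
  degree-elsewhere x≢u x≢si = complement-bound (degree-pair-bound x≢si x≢u s-i≢u)
    (length≤count (adj G (s i)) junction-unique junction-adjacent)

  junction-closure : ∀ {y} → adj G (s i) y ≡ true → Consecutive s j (s i) y
  junction-closure e
    with ∈-of-count≤length (adj G (s i)) degree-junction junction-unique junction-adjacent e
  ... | here y≡before = pred i , before<j 0<i , inj₂ (sym y≡before , s-before 0<i)
  ... | there (here y≡after) = i , i<j , inj₁ (refl , sym y≡after)
  ... | there (there (here y≡last)) = pred j , last<j , inj₂ (sym y≡last , s-last)

  path-closure : ∀ {a y} → suc a < j → s (suc a) ≢ s i → adj G (s (suc a)) y ≡ true →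
    Consecutive s j (s (suc a)) y
  path-closure {a} a+1<j sa≢si e
    with ∈-of-count≤length (adj G (s (suc a))) (degree-elsewhere (s-≢-u (s≤s z≤n) a+1<j) sa≢si)
           ((s-turns a+1<j ∘ sym ∷ []) ∷ [] ∷ [])
           (adj-flip G (s-adjacent (<-trans (n<1+n a) a+1<j)) ∷ s-adjacent a+1<j ∷ []) e
  ... | here y≡prev = a , <-trans (n<1+n a) a+1<j , inj₂ (sym y≡prev , refl)
  ... | there (here y≡next) = suc a , a+1<j , inj₁ (refl , sym y≡next)

  closure : ∀ {a y} → a < j → adj G (s a) y ≡ true → Consecutive s j (s a) y
  closure {zero} _ e = 0 , 0<j , inj₁ (refl , sym (u-neighbour-unique e))
  closure {suc a} {y} a<j e with s (suc a) ≟ s i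
  ... | yes sa≡si =
    subst (λ x → Consecutive s j x y) (sym sa≡si) (junction-closure (subst (λ x → adj G x y ≡ true) sa≡si e))
  ... | no sa≢si = path-closure a<j sa≢si e

  Covered : Fin n → Set
  Covered x = ∃ λ k → k < j × s k ≡ x

  consecutive-covered : ∀ {x y} → Consecutive s j x y → Covered y
  consecutive-covered (k , k<j , inj₂ (sk≡y , _)) = k , k<j , sk≡y
  consecutive-covered (k , k<j , inj₁ (_ , sk+1≡y)) with m≤n⇒m<n∨m≡n k<j
  ... | inj₁ k+1<j = suc k , k+1<j , sk+1≡y
  ... | inj₂ k+1≡j = i , i<j , trans (sym s-closes) (trans (cong s (sym k+1≡j)) sk+1≡y)

  covered-walk : ∀ {x y m} → Walk G x y m → Covered x → Covered y
  covered-walk here c = c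
  covered-walk (step e p) (k , k<j , refl) = covered-walk p (consecutive-covered (closure k<j e))

  s-surjective : ∀ x → Covered x
  s-surjective x = covered-walk (proj₂ (proj₁ unicyclic u x)) (0 , 0<j , refl)

  s-edges : ∀ {x y} → adj G x y ≡ true → Consecutive s j x y
  s-edges {x} e with s-surjective x
  ... | k , k<j , refl = closure k<j e

  tadpole : Tadpole G
  tadpole = record { lasso = lasso ; s-surjective = s-surjective ; s-edges = s-edges }

-- A cycle has no end-vertex, so ¬ IsCycleGraph G follows from the last hypothesis.
theorem25 : (n : ℕ) (G : Graph n) → Unicyclic G → ¬ IsCycleGraph G →
    numEndVertices G ≡ 1 → StrongPartitionDimension G 3
theorem25 n G unicyclic _ one-end = (partition , resolving) , tadpole-lower-bound tadpole 0<i
  where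
  open OneEndVertex G unicyclic one-end using (tadpole; 0<i)
  open TadpolePartition tadpole using (partition; resolving)
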